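{- Let $A\in\mathbb{C}$ with $A(A^2+4)\ne0$, and let $(w_i)_{i\ge0}$ be a sequence of complex numbers with $w_{i+1}=Aw_i+w_{i-1}$ for all $i=1,2,3,\ldots$. Then for any positive even integer $n$, the characteristic polynomial $\det[x\delta_{jk}-w_{j+k}]_{0\le j,k\le n-1}$ of the matrix $[w_{j+k}]_{0\le j,k\le n-1}$ equals $$x^n-\big(w_1v_{n-1}(A,-1)+w_0v_{n-2}(A,-1)\big)\frac{u_n(A,-1)}{A}\,x^{n-1}+(w_0^2+Aw_0w_1-w_1^2)\frac{u_n(A,-1)^2}{A^2}\,x^{n-2},$$ where $\delta_{jk}$ is $1$ if $j=k$ and $0$ otherwise.
   Context: For $a,b\in\mathbb{C}$, the Lucas sequences are defined by $u_0(a,b)=0$, $u_1(a,b)=1$, $v_0(a,b)=2$, $v_1(a,b)=a$, and $u_{m+1}(a,b)=au_m(a,b)-bu_{m-1}(a,b)$, $v_{m+1}(a,b)=av_m(a,b)-bv_{m-1}(a,b)$ for $m\ge1$. The convention $0^0=1$ is used. -}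

module Defs where

open import Level using (Level)
open import Data.Nat using (ℕ; zero; suc)
open import Data.Fin using (Fin; zero; suc; punchIn; toℕ)
open import Algebra.Bundles using (CommutativeRing)
open import Relation.Nullary using (¬_)
open import Data.Product using (_×_; Σ)
open import Relation.Binary.PropositionalEquality using (_≡_)

module _ {c ℓ : Level} (R : CommutativeRing c ℓ) where
  open CommutativeRing R hiding (zero)

  pow : Carrier → ℕ → Carrier
  pow x zero    = 1#
  pow x (suc n) = x * pow x n

  natR : ℕ → Carrier
  natR zero    = 0#
  natR (suc n) = 1# + natR n

  sgn : ℕ → Carrier
  sgn zero    = 1#
  sgn (suc k) = - sgn k

  sumFin : (n : ℕ) → (Fin n → Carrier) → Carrier
  sumFin zero    f = 0#
  sumFin (suc n) f = f zero + sumFin n (λ i → f (suc i))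

  det : (n : ℕ) → (Fin n → Fin n → Carrier) → Carrier
  det zero    M = 1#
  det (suc n) M =
    sumFin (suc n) (λ j → sgn (toℕ j) * (M zero j * det n (λ r s → M (suc r) (punchIn j s))))

  δ : {n : ℕ} → Fin n → Fin n → Carrier
  δ zero    zero    = 1#
  δ zero    (suc k) = 0#
  δ (suc j) zero    = 0#
  δ (suc j) (suc k) = δ j k

  lucasU : Carrier → Carrier → ℕ → Carrier
  lucasU a b zero          = 0#
  lucasU a b (suc zero)    = 1#
  lucasU a b (suc (suc m)) = a * lucasU a b (suc m) - b * lucasU a b m

  lucasV : Carrier → Carrier → ℕ → Carrier
  lucasV a b zero          = 1# + 1#
  lucasV a b (suc zero)    = a
  lucasV a b (suc (suc m)) = a * lucasV a b (suc m) - b * lucasV a b m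

  IsFieldR : Set (c Level.⊔ ℓ)
  IsFieldR = (¬ (1# ≈ 0#)) × ((x : Carrier) → ¬ (x ≈ 0#) → Σ Carrier (λ y → x * y ≈ 1#))

  CharZero : Set ℓ
  CharZero = (m : ℕ) → natR m ≈ 0# → m ≡ 0

-- With u = u(A, -1) and u₋ k = u (k - 1), the recurrence gives
-- w (j + k) = u j · w (k + 1) + u₋ j · w k, so the Hankel matrix is a c^T + b d^T with
-- a = (u j), b = (u₋ j), c = (w (k + 1)), d = (w k). Applying the matrix determinant lemma twice,
-- det (x I - a c^T - b d^T) = x^n - (a·c + b·d) x^(n-1) + ((b·d)(a·c) - (b·c)(a·d)) x^(n-2).
-- The four dot products are combinations of Σ u_k², Σ u_k u_(k+1), Σ u_(k+1)², and A times these
-- telescope to u_n u_(n-1), u_n² (n even) and u_n u_(n+1); Cassini's identity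
-- u_(n+1) u_(n-1) - u_n² = (-1)^n = 1 then yields the two stated coefficients.
module Submission where

open import Defs
open import Level using (Level)
open import Data.Nat using (ℕ; suc; _<_; _∸_) renaming (_+_ to _+ℕ_)
open import Data.Nat.Divisibility using (_∣_)
open import Data.Fin using (toℕ)
open import Algebra.Bundles using (CommutativeRing)
open import Relation.Nullary using (¬_)

open import Data.Nat using (zero)
import Data.Nat as ℕ
import Data.Nat.Properties as ℕ
open import Data.Nat.Divisibility using (divides)
open import Data.Fin using (Fin; zero; suc; punchIn; punchOut)
import Data.Fin.Properties as Fin
import Data.Integer as ℤ
import Data.Integer.Properties as ℤ
open import Data.Sign as Sign using (Sign)
open import Data.Maybe using (Maybe; map)
open import Data.Vec.Functional using (updateAt)
import Data.Vec.Functional.Properties as Vector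
open import Data.Empty using (⊥-elim)
open import Function using (_∘_; const)
open import Relation.Nullary using (yes; no)
open import Relation.Binary.Consequences using (dec⇒weaklyDec)
open import Relation.Binary.PropositionalEquality as ≡ using (_≡_; _≢_)
import Algebra.Solver.Ring.AlmostCommutativeRing as ACR

-- The ring solver needs coefficients with decidable equality to see cancellations such as
-- x - x ≈ 0#; the integers, mapped into R by their canonical homomorphism, provide them.
module IntegerSolver {ℓ₁ ℓ₂ : Level} (R : CommutativeRing ℓ₁ ℓ₂) where
  open import Data.Integer using (ℤ; +_; -[1+_]; _⊖_; sign; ∣_∣; _◃_)
  open CommutativeRing R
  open import Algebra.Properties.Semiring.Mult.TCOptimised semiring using (_×_; ×-homo-+; ×1-homo-*)
  open import Algebra.Properties.Ring ring using (-‿involutive; -0#≈0#; -1*x≈-x)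
  open import Algebra.Properties.AbelianGroup +-abelianGroup using (⁻¹-∙-comm)
  open import Algebra.Properties.CommutativeSemigroup +-commutativeSemigroup using () renaming (interchange to +-interchange)
  open import Algebra.Properties.CommutativeSemigroup *-commutativeSemigroup using () renaming (interchange to *-interchange)
  open import Relation.Binary.Reasoning.Setoid setoid

  -- The optimised _×_ has 1 × 1# = 1#, so the constant con (+ 1) denotes 1# itself.
  fromℤ : ℤ → Carrier
  fromℤ (+ n)    = n × 1#
  fromℤ -[1+ n ] = - (suc n × 1#)

  fromSign : Sign → Carrier
  fromSign Sign.+ = 1#
  fromSign Sign.- = - 1#

  x+y-[x+z]≈y-z : ∀ x y z → (x + y) - (x + z) ≈ y - z
  x+y-[x+z]≈y-z x y z = begin
    (x + y) - (x + z)     ≈⟨ +-congˡ (⁻¹-∙-comm x z) ⟨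
    (x + y) + (- x - z)   ≈⟨ +-interchange x y (- x) (- z) ⟩
    (x - x) + (y - z)     ≈⟨ +-congʳ (-‿inverseʳ x) ⟩
    0# + (y - z)          ≈⟨ +-identityˡ _ ⟩
    y - z                 ∎

  fromℤ-⊖ : ∀ m n → fromℤ (m ⊖ n) ≈ m × 1# - n × 1#
  fromℤ-⊖ zero    zero    = sym (-‿inverseʳ 0#)
  fromℤ-⊖ zero    (suc n) = sym (+-identityˡ _)
  fromℤ-⊖ (suc m) zero    = sym (trans (+-congˡ -0#≈0#) (+-identityʳ _))
  fromℤ-⊖ (suc m) (suc n) = begin
    fromℤ (suc m ⊖ suc n)               ≡⟨ ≡.cong fromℤ (ℤ.[1+m]⊖[1+n]≡m⊖n m n) ⟩
    fromℤ (m ⊖ n)                       ≈⟨ fromℤ-⊖ m n ⟩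
    m × 1# - n × 1#                     ≈⟨ x+y-[x+z]≈y-z 1# _ _ ⟨
    (1# + m × 1#) - (1# + n × 1#)       ≈⟨ +-cong (×-homo-+ 1# 1 m) (-‿cong (×-homo-+ 1# 1 n)) ⟨
    suc m × 1# - suc n × 1#             ∎

  fromℤ-+ : ∀ i j → fromℤ (i ℤ.+ j) ≈ fromℤ i + fromℤ j
  fromℤ-+ (+ m)    (+ n)    = ×-homo-+ 1# m n
  fromℤ-+ (+ m)    -[1+ n ] = fromℤ-⊖ m (suc n)
  fromℤ-+ -[1+ m ] (+ n)    = trans (fromℤ-⊖ n (suc m)) (+-comm _ _)
  fromℤ-+ -[1+ m ] -[1+ n ] = begin
    - (suc (suc (m ℕ.+ n)) × 1#)        ≡⟨ ≡.cong (λ k → - (k × 1#)) (≡.sym (ℕ.+-suc (suc m) n)) ⟩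
    - ((suc m ℕ.+ suc n) × 1#)          ≈⟨ -‿cong (×-homo-+ 1# (suc m) (suc n)) ⟩
    - (suc m × 1# + suc n × 1#)         ≈⟨ ⁻¹-∙-comm _ _ ⟨
    - (suc m × 1#) - (suc n × 1#)       ∎

  fromℤ-neg : ∀ i → fromℤ (ℤ.- i) ≈ - fromℤ i
  fromℤ-neg (+ zero)  = sym -0#≈0#
  fromℤ-neg (+ suc n) = refl
  fromℤ-neg -[1+ n ]  = sym (-‿involutive _)

  fromSign-* : ∀ s t → fromSign (s Sign.* t) ≈ fromSign s * fromSign t
  fromSign-* Sign.+ t      = sym (*-identityˡ _)
  fromSign-* Sign.- Sign.+ = sym (*-identityʳ _)
  fromSign-* Sign.- Sign.- = sym (trans (-1*x≈-x (- 1#)) (-‿involutive 1#))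

  fromℤ-◃ : ∀ s n → fromℤ (s ◃ n) ≈ fromSign s * (n × 1#)
  fromℤ-◃ s      zero    = sym (zeroʳ _)
  fromℤ-◃ Sign.+ (suc n) = sym (*-identityˡ _)
  fromℤ-◃ Sign.- (suc n) = sym (-1*x≈-x _)

  fromℤ≈sign*abs : ∀ i → fromℤ i ≈ fromSign (sign i) * (∣ i ∣ × 1#)
  fromℤ≈sign*abs i = trans (reflexive (≡.cong fromℤ (≡.sym (ℤ.◃-inverse i)))) (fromℤ-◃ (sign i) ∣ i ∣)

  fromℤ-* : ∀ i j → fromℤ (i ℤ.* j) ≈ fromℤ i * fromℤ j
  fromℤ-* i j = begin
    fromℤ (sign i Sign.* sign j ◃ ∣ i ∣ ℕ.* ∣ j ∣)
      ≈⟨ fromℤ-◃ (sign i Sign.* sign j) (∣ i ∣ ℕ.* ∣ j ∣) ⟩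
    fromSign (sign i Sign.* sign j) * ((∣ i ∣ ℕ.* ∣ j ∣) × 1#)
      ≈⟨ *-cong (fromSign-* (sign i) (sign j)) (×1-homo-* ∣ i ∣ ∣ j ∣) ⟩
    (fromSign (sign i) * fromSign (sign j)) * ((∣ i ∣ × 1#) * (∣ j ∣ × 1#))
      ≈⟨ *-interchange _ _ _ _ ⟩
    (fromSign (sign i) * (∣ i ∣ × 1#)) * (fromSign (sign j) * (∣ j ∣ × 1#))
      ≈⟨ *-cong (fromℤ≈sign*abs i) (fromℤ≈sign*abs j) ⟨
    fromℤ i * fromℤ j ∎

  fromℤ-homomorphism : CommutativeRing.rawRing ℤ.+-*-commutativeRing ACR.-Raw-AlmostCommutative⟶ ACR.fromCommutativeRing R
  fromℤ-homomorphism = record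
    { ⟦_⟧    = fromℤ
    ; +-homo = fromℤ-+
    ; *-homo = fromℤ-*
    ; -‿homo = fromℤ-neg
    ; 0-homo = refl
    ; 1-homo = refl
    }

  coefficient-equality : ∀ i j → Maybe (fromℤ i ≈ fromℤ j)
  coefficient-equality i j = map (λ { ≡.refl → refl }) (dec⇒weaklyDec ℤ._≟_ i j)

  open import Algebra.Solver.Ring (CommutativeRing.rawRing ℤ.+-*-commutativeRing) (ACR.fromCommutativeRing R) fromℤ-homomorphism coefficient-equality public
    using (solve; _:=_; _:+_; _:*_; _:-_; :-_; con)

module FiniteSums {ℓ₁ ℓ₂ : Level} (R : CommutativeRing ℓ₁ ℓ₂) where
  open CommutativeRing R hiding (zero)
  open import Algebra.Properties.Semiring.Sum semiring public
    using (sum; sum-syntax; sum-cong-≋; ∑-distrib-+; ∑-comm; sum-remove; *-distribˡ-sum; *-distribʳ-sum)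
  open import Algebra.Properties.Semiring.Sum semiring using (sum-replicate-zero; sum-init-last)
  open import Algebra.Properties.Ring ring using (-1*x≈-x)
  open import Relation.Binary.Reasoning.Setoid setoid

  sumFin≡sum : ∀ n (f : Fin n → Carrier) → sumFin R n f ≡ sum f
  sumFin≡sum zero    f = ≡.refl
  sumFin≡sum (suc n) f = ≡.cong (f zero +_) (sumFin≡sum n (f ∘ suc))

  sum-zero : ∀ {n} (f : Fin n → Carrier) → (∀ i → f i ≈ 0#) → sum f ≈ 0#
  sum-zero {n} f f≈0 = trans (sum-cong-≋ f≈0) (sum-replicate-zero n)

  sum-neg : ∀ {n} (f : Fin n → Carrier) → ∑[ i < n ] (- f i) ≈ - sum f
  sum-neg f = begin
    sum (λ i → - f i)      ≈⟨ sum-cong-≋ (λ i → -1*x≈-x (f i)) ⟨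
    sum (λ i → - 1# * f i) ≈⟨ *-distribˡ-sum (- 1#) f ⟨
    - 1# * sum f           ≈⟨ -1*x≈-x (sum f) ⟩
    - sum f                ∎

  sum-distrib-- : ∀ {n} (f g : Fin n → Carrier) → ∑[ i < n ] (f i - g i) ≈ sum f - sum g
  sum-distrib-- f g = trans (∑-distrib-+ f (λ i → - g i)) (+-congˡ (sum-neg g))

  infix 8 _·_
  _·_ : ∀ {n} → (Fin n → Carrier) → (Fin n → Carrier) → Carrier
  a · c = ∑[ i < _ ] (a i * c i)

  sum-linear : ∀ {n} α β (f g : Fin n → Carrier) → ∑[ i < n ] (α * f i + β * g i) ≈ α * sum f + β * sum g
  sum-linear α β f g = trans (∑-distrib-+ (λ i → α * f i) (λ i → β * g i)) (sym (+-cong (*-distribˡ-sum α f) (*-distribˡ-sum β g)))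

  sum-single : ∀ {n} (f : Fin (suc n) → Carrier) (j : Fin (suc n)) → (∀ k → k ≢ j → f k ≈ 0#) → sum f ≈ f j
  sum-single f j f≈0 = begin
    sum f                          ≈⟨ sum-remove f ⟩
    f j + sum (f ∘ punchIn j)      ≈⟨ +-congˡ (sum-zero (f ∘ punchIn j) (λ s → f≈0 (punchIn j s) (Fin.punchInᵢ≢i j s))) ⟩
    f j + 0#                       ≈⟨ +-identityʳ (f j) ⟩
    f j                            ∎

  -- The off-diagonal terms cancel in pairs (j, k), (k, j); no division by 2 is needed.
  sum-antisymmetric : ∀ {n} (f : Fin n → Fin n → Carrier) → (∀ j → f j j ≈ 0#) → (∀ j k → f k j ≈ - f j k) →
                      ∑[ j < n ] ∑[ k < n ] f j k ≈ 0#
  sum-antisymmetric {zero}  f diag anti = refl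
  sum-antisymmetric {suc n} f diag anti = begin
    (f zero zero + ∑[ k < n ] f zero (suc k)) + ∑[ j < n ] (f (suc j) zero + ∑[ k < n ] f (suc j) (suc k))
      ≈⟨ +-cong (+-congʳ (diag zero)) (∑-distrib-+ (λ j → f (suc j) zero) _) ⟩
    (0# + ∑[ k < n ] f zero (suc k)) + (∑[ j < n ] f (suc j) zero + ∑[ j < n ] ∑[ k < n ] f (suc j) (suc k))
      ≈⟨ +-cong (+-identityˡ _) (+-cong (trans (sum-cong-≋ (λ j → anti zero (suc j))) (sum-neg (λ k → f zero (suc k))))
                                        (sum-antisymmetric (λ j k → f (suc j) (suc k)) (diag ∘ suc) (λ j k → anti (suc j) (suc k)))) ⟩
    ∑[ k < n ] f zero (suc k) + (- ∑[ k < n ] f zero (suc k) + 0#)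
      ≈⟨ +-congˡ (+-identityʳ _) ⟩
    ∑[ k < n ] f zero (suc k) - ∑[ k < n ] f zero (suc k)
      ≈⟨ -‿inverseʳ _ ⟩
    0# ∎

  sum-snoc : ∀ n (f : ℕ → Carrier) → ∑[ i < suc n ] f (toℕ i) ≈ ∑[ i < n ] f (toℕ i) + f n
  sum-snoc n f = trans (sum-init-last {n} (f ∘ toℕ))
    (+-cong (reflexive (sum-cong-≗ {n} (λ i → ≡.cong f (Fin.toℕ-inject₁ i)))) (reflexive (≡.cong f (Fin.toℕ-fromℕ n))))
    where open import Algebra.Properties.Semiring.Sum semiring using (sum-cong-≗)

punchIn-punchOut-comm : ∀ {n} (a b : Fin (suc (suc n))) (a≢b : a ≢ b) (b≢a : b ≢ a) (t : Fin n) →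
                        punchIn a (punchIn (punchOut a≢b) t) ≡ punchIn b (punchIn (punchOut b≢a) t)
punchIn-punchOut-comm zero    zero    a≢b b≢a t = ⊥-elim (a≢b ≡.refl)
punchIn-punchOut-comm zero    (suc b) a≢b b≢a t = ≡.refl
punchIn-punchOut-comm (suc a) zero    a≢b b≢a t = ≡.refl
punchIn-punchOut-comm {suc n} (suc a) (suc b) a≢b b≢a zero    = ≡.refl
punchIn-punchOut-comm {suc n} (suc a) (suc b) a≢b b≢a (suc t) =
  ≡.cong suc (punchIn-punchOut-comm a b (a≢b ∘ ≡.cong suc) (b≢a ∘ ≡.cong suc) t)

module Determinants {ℓ₁ ℓ₂ : Level} (R : CommutativeRing ℓ₁ ℓ₂) where
  open import Data.Integer using (+_)
  open CommutativeRing R hiding (zero)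
  open import Algebra.Properties.Ring ring using (-‿distribˡ-*; -‿distribʳ-*; -0#≈0#)
  open import Relation.Binary.Reasoning.Setoid setoid
  open IntegerSolver R using (solve; _:=_; _:+_; _:*_; _:-_; :-_; con)
  open FiniteSums R

  Matrix : ℕ → Set ℓ₁
  Matrix n = Fin n → Fin n → Carrier

  minor : ∀ {n} → Fin (suc n) → Matrix (suc n) → Matrix n
  minor j M r s = M (suc r) (punchIn j s)

  laplaceTerm : ∀ n → Matrix (suc n) → Fin (suc n) → Carrier
  laplaceTerm n M j = sgn R (toℕ j) * (M zero j * det R n (minor j M))

  det-suc : ∀ n (M : Matrix (suc n)) → det R (suc n) M ≈ sum (laplaceTerm n M)
  det-suc n M = reflexive (sumFin≡sum (suc n) (laplaceTerm n M))

  laplaceTerm-zero : ∀ n (M : Matrix (suc n)) j → M zero j * det R n (minor j M) ≈ 0# → laplaceTerm n M j ≈ 0#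
  laplaceTerm-zero n M j eq = trans (*-congˡ eq) (zeroʳ _)

  det-cong : ∀ n {M N : Matrix n} → (∀ i j → M i j ≈ N i j) → det R n M ≈ det R n N
  det-cong zero    M≈N = refl
  det-cong (suc n) {M} {N} M≈N = begin
    det R (suc n) M         ≈⟨ det-suc n M ⟩
    sum (laplaceTerm n M)   ≈⟨ sum-cong-≋ (λ j → *-congˡ {sgn R (toℕ j)} (*-cong (M≈N zero j) (det-cong n (λ r s → M≈N (suc r) (punchIn j s))))) ⟩
    sum (laplaceTerm n N)   ≈⟨ det-suc n N ⟨
    det R (suc n) N         ∎

  det-zero-row : ∀ n (M : Matrix n) i → (∀ s → M i s ≈ 0#) → det R n M ≈ 0#
  det-zero-row (suc n) M zero    M₀≈0 =
    trans (det-suc n M) (sum-zero _ (λ j → laplaceTerm-zero n M j (trans (*-congʳ (M₀≈0 j)) (zeroˡ _))))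
  det-zero-row (suc n) M (suc i) Mᵢ≈0 =
    trans (det-suc n M) (sum-zero _ (λ j → laplaceTerm-zero n M j
      (trans (*-congˡ (det-zero-row n (minor j M) i (λ s → Mᵢ≈0 (punchIn j s)))) (zeroʳ _))))

  det-single-term : ∀ n (M : Matrix (suc n)) c → (∀ k → k ≢ c → laplaceTerm n M k ≈ 0#) → det R (suc n) M ≈ laplaceTerm n M c
  det-single-term n M c others≈0 = trans (det-suc n M) (sum-single (laplaceTerm n M) c others≈0)

  det-single-entry-row₀ : ∀ n (M : Matrix (suc n)) c → (∀ s → s ≢ c → M zero s ≈ 0#) → det R (suc n) M ≈ laplaceTerm n M c
  det-single-entry-row₀ n M c M₀≈0 =
    det-single-term n M c (λ s s≢c → laplaceTerm-zero n M s (trans (*-congʳ (M₀≈0 s s≢c)) (zeroˡ _)))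

  sgn-punchOut : ∀ {n} (a b : Fin (suc (suc n))) (a≢b : a ≢ b) (b≢a : b ≢ a) →
                 sgn R (toℕ a) * sgn R (toℕ (punchOut a≢b)) ≈ - (sgn R (toℕ b) * sgn R (toℕ (punchOut b≢a)))
  sgn-punchOut zero    zero    a≢b b≢a = ⊥-elim (a≢b ≡.refl)
  sgn-punchOut zero    (suc b) a≢b b≢a = solve 1 (λ s → con (+ 1) :* s := :- ((:- s) :* con (+ 1))) refl _
  sgn-punchOut (suc a) zero    a≢b b≢a = solve 1 (λ s → (:- s) :* con (+ 1) := :- (con (+ 1) :* s)) refl _
  sgn-punchOut {zero}  (suc zero) (suc zero) a≢b b≢a = ⊥-elim (a≢b ≡.refl)
  sgn-punchOut {suc n} (suc a) (suc b) a≢b b≢a = begin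
    (- sgn R (toℕ a)) * (- sgn R (toℕ (punchOut a≢b′)))   ≈⟨ neg*neg _ _ ⟩
    sgn R (toℕ a) * sgn R (toℕ (punchOut a≢b′))           ≈⟨ sgn-punchOut a b a≢b′ b≢a′ ⟩
    - (sgn R (toℕ b) * sgn R (toℕ (punchOut b≢a′)))       ≈⟨ -‿cong (neg*neg _ _) ⟨
    - ((- sgn R (toℕ b)) * (- sgn R (toℕ (punchOut b≢a′)))) ∎
    where
    a≢b′ : a ≢ b
    a≢b′ = a≢b ∘ ≡.cong suc
    b≢a′ : b ≢ a
    b≢a′ = b≢a ∘ ≡.cong suc
    neg*neg : ∀ x y → (- x) * (- y) ≈ x * y
    neg*neg = solve 2 (λ x y → (:- x) :* (:- y) := x :* y) refl

  -- Expanding along the first two rows y, z writes the determinant as Σ_j Σ_k y_j z_k (kernel j k),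
  -- with a kernel that is antisymmetric and vanishes on the diagonal.
  module ExpansionAlongTwoRows {n} (W : Fin n → Fin (suc (suc n)) → Carrier) where
    withRows : (y z : Fin (suc (suc n)) → Carrier) → Matrix (suc (suc n))
    withRows y z zero          = y
    withRows y z (suc zero)    = z
    withRows y z (suc (suc r)) = W r

    complementaryMinor : Fin (suc (suc n)) → Fin (suc n) → Carrier
    complementaryMinor j s = det R n (λ r t → W r (punchIn j (punchIn s t)))

    kernel : Fin (suc (suc n)) → Fin (suc (suc n)) → Carrier
    kernel j k with j Fin.≟ k
    ... | yes _   = 0#
    ... | no j≢k = (sgn R (toℕ j) * sgn R (toℕ (punchOut j≢k))) * complementaryMinor j (punchOut j≢k)

    kernel-diag : ∀ j → kernel j j ≈ 0#
    kernel-diag j with j Fin.≟ j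
    ... | yes _   = refl
    ... | no j≢j = ⊥-elim (j≢j ≡.refl)

    kernel-punchIn : ∀ j s → kernel j (punchIn j s) ≈ (sgn R (toℕ j) * sgn R (toℕ s)) * complementaryMinor j s
    kernel-punchIn j s with j Fin.≟ punchIn j s
    ... | yes j≡ = ⊥-elim (Fin.punchInᵢ≢i j s (≡.sym j≡))
    ... | no j≢  = reflexive (≡.cong (λ u → (sgn R (toℕ j) * sgn R (toℕ u)) * complementaryMinor j u)
                                     (≡.trans (Fin.punchOut-cong j ≡.refl) (Fin.punchOut-punchIn j)))

    kernel-anti : ∀ j k → kernel k j ≈ - kernel j k
    kernel-anti j k with j Fin.≟ k | k Fin.≟ j
    ... | yes _   | yes _   = sym -0#≈0#
    ... | yes j≡k | no k≢j = ⊥-elim (k≢j (≡.sym j≡k))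
    ... | no j≢k | yes k≡j = ⊥-elim (j≢k (≡.sym k≡j))
    ... | no j≢k | no k≢j = begin
      (sgn R (toℕ k) * sgn R (toℕ (punchOut k≢j))) * complementaryMinor k (punchOut k≢j)
        ≈⟨ *-cong (sgn-punchOut k j k≢j j≢k) (det-cong n (λ r t → reflexive (≡.cong (W r) (punchIn-punchOut-comm k j k≢j j≢k t)))) ⟩
      (- (sgn R (toℕ j) * sgn R (toℕ (punchOut j≢k)))) * complementaryMinor j (punchOut j≢k)
        ≈⟨ -‿distribˡ-* _ _ ⟨
      - ((sgn R (toℕ j) * sgn R (toℕ (punchOut j≢k))) * complementaryMinor j (punchOut j≢k)) ∎

    det-withRows : ∀ y z → det R (suc (suc n)) (withRows y z) ≈ ∑[ j < suc (suc n) ] ∑[ k < suc (suc n) ] ((y j * z k) * kernel j k)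
    det-withRows y z = trans (det-suc (suc n) (withRows y z)) (sum-cong-≋ row)
      where
      secondRowTerm : Fin (suc (suc n)) → Fin (suc n) → Carrier
      secondRowTerm j s = sgn R (toℕ s) * (z (punchIn j s) * complementaryMinor j s)
      rearrange : ∀ a b c d e → a * (b * (c * (d * e))) ≈ (b * d) * ((a * c) * e)
      rearrange = solve 5 (λ a b c d e → a :* (b :* (c :* (d :* e))) := (b :* d) :* ((a :* c) :* e)) refl
      row : ∀ j → laplaceTerm (suc n) (withRows y z) j ≈ ∑[ k < suc (suc n) ] ((y j * z k) * kernel j k)
      row j = begin
        sgn R (toℕ j) * (y j * det R (suc n) (minor j (withRows y z)))
          ≈⟨ *-congˡ {sgn R (toℕ j)} (*-congˡ {y j} (det-suc n (minor j (withRows y z)))) ⟩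
        sgn R (toℕ j) * (y j * sum (secondRowTerm j))
          ≈⟨ *-congˡ {sgn R (toℕ j)} (*-distribˡ-sum (y j) (secondRowTerm j)) ⟩
        sgn R (toℕ j) * ∑[ s < suc n ] (y j * secondRowTerm j s)
          ≈⟨ *-distribˡ-sum (sgn R (toℕ j)) (λ s → y j * secondRowTerm j s) ⟩
        ∑[ s < suc n ] (sgn R (toℕ j) * (y j * secondRowTerm j s))
          ≈⟨ sum-cong-≋ (λ s → trans (rearrange _ (y j) _ (z (punchIn j s)) _) (*-congˡ {y j * z (punchIn j s)} (sym (kernel-punchIn j s)))) ⟩
        ∑[ s < suc n ] ((y j * z (punchIn j s)) * kernel j (punchIn j s))
          ≈⟨ +-identityˡ _ ⟨
        0# + ∑[ s < suc n ] ((y j * z (punchIn j s)) * kernel j (punchIn j s))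
          ≈⟨ +-congʳ (trans (*-congˡ (kernel-diag j)) (zeroʳ _)) ⟨
        (y j * z j) * kernel j j + ∑[ s < suc n ] ((y j * z (punchIn j s)) * kernel j (punchIn j s))
          ≈⟨ sum-remove (λ k → (y j * z k) * kernel j k) ⟨
        ∑[ k < suc (suc n) ] ((y j * z k) * kernel j k) ∎

    det-withRows-swap : ∀ y z → det R (suc (suc n)) (withRows z y) ≈ - det R (suc (suc n)) (withRows y z)
    det-withRows-swap y z = begin
      det R N (withRows z y)                          ≈⟨ det-withRows z y ⟩
      ∑[ j < N ] ∑[ k < N ] ((z j * y k) * kernel j k) ≈⟨ ∑-comm (λ j k → (z j * y k) * kernel j k) ⟩
      ∑[ k < N ] ∑[ j < N ] ((z j * y k) * kernel j k) ≈⟨ sum-cong-≋ (λ k → trans (sum-cong-≋ (λ j → flip k j)) (sum-neg (λ j → (y k * z j) * kernel k j))) ⟩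
      ∑[ k < N ] (- ∑[ j < N ] ((y k * z j) * kernel k j)) ≈⟨ sum-neg (λ k → ∑[ j < N ] ((y k * z j) * kernel k j)) ⟩
      - ∑[ k < N ] ∑[ j < N ] ((y k * z j) * kernel k j) ≈⟨ -‿cong (det-withRows y z) ⟨
      - det R N (withRows y z)                        ∎
      where
      N : ℕ
      N = suc (suc n)
      flip : ∀ k j → (z j * y k) * kernel j k ≈ - ((y k * z j) * kernel k j)
      flip k j = trans (*-cong (*-comm _ _) (kernel-anti k j)) (sym (-‿distribʳ-* _ _))

    det-withRows-equal : ∀ y → det R (suc (suc n)) (withRows y y) ≈ 0#
    det-withRows-equal y = trans (det-withRows y y)
      (sum-antisymmetric (λ j k → (y j * y k) * kernel j k) (λ j → trans (*-congˡ {y j * y j} (kernel-diag j)) (zeroʳ _))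
                           (λ j k → trans (*-cong (*-comm _ _) (kernel-anti j k)) (sym (-‿distribʳ-* _ _))))

  det-equal-rows : ∀ n (M : Matrix (suc (suc n))) i → (∀ s → M zero s ≈ M (suc i) s) → det R (suc (suc n)) M ≈ 0#
  det-equal-rows n M zero M₀≈M₁ = begin
    det R (suc (suc n)) M                    ≈⟨ det-cong (suc (suc n)) rows ⟩
    det R (suc (suc n)) (withRows (M zero) (M zero)) ≈⟨ det-withRows-equal (M zero) ⟩
    0#                                       ∎
    where
    open ExpansionAlongTwoRows (λ r → M (suc (suc r)))
    rows : ∀ r s → M r s ≈ withRows (M zero) (M zero) r s
    rows zero          s = refl
    rows (suc zero)    s = sym (M₀≈M₁ s)
    rows (suc (suc r)) s = refl
  det-equal-rows (suc n) M (suc i) M₀≈Mᵢ = begin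
    det R N M                                   ≈⟨ det-cong N rows ⟩
    det R N (withRows (M zero) (M (suc zero)))  ≈⟨ det-withRows-swap (M (suc zero)) (M zero) ⟩
    - det R N swapped                           ≈⟨ -‿cong (trans (det-suc (suc (suc n)) swapped) (sum-zero (laplaceTerm (suc (suc n)) swapped) minors-vanish)) ⟩
    - 0#                                        ≈⟨ -0#≈0# ⟩
    0#                                          ∎
    where
    N : ℕ
    N = suc (suc (suc n))
    open ExpansionAlongTwoRows (λ r → M (suc (suc r)))
    rows : ∀ r s → M r s ≈ withRows (M zero) (M (suc zero)) r s
    rows zero          s = refl
    rows (suc zero)    s = refl
    rows (suc (suc r)) s = refl
    swapped : Matrix N
    swapped = withRows (M (suc zero)) (M zero)
    -- after swapping the first two rows, every first-row minor has two equal rows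
    minors-vanish : ∀ j → laplaceTerm (suc (suc n)) swapped j ≈ 0#
    minors-vanish j = laplaceTerm-zero (suc (suc n)) swapped j
      (trans (*-congˡ (det-equal-rows n (minor j swapped) i (λ s → M₀≈Mᵢ (punchIn j s)))) (zeroʳ _))

  replaceRow : ∀ {n} → Matrix n → Fin n → (Fin n → Carrier) → Matrix n
  replaceRow M i y = updateAt M i (const y)

  minor-replaceRow : ∀ {n} k (B : Matrix (suc n)) i d r s →
                     minor k (replaceRow B (suc i) d) r s ≡ replaceRow (minor k B) i (d ∘ punchIn k) r s
  minor-replaceRow k B i d r s =
    ≡.cong-app (Vector.map-updateAt {f = _∘ punchIn k} {g = const d} (λ _ → ≡.refl) (λ r → B (suc r)) i r) s

  sum-laplace-replaceRow : ∀ n (B : Matrix (suc n)) (b d : Fin (suc n) → Carrier) →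
    ∑[ k < suc n ] (sgn R (toℕ k) * (B zero k * ∑[ i < n ] (b (suc i) * det R n (replaceRow (minor k B) i (d ∘ punchIn k)))))
      ≈ ∑[ i < n ] (b (suc i) * det R (suc n) (replaceRow B (suc i) d))
  sum-laplace-replaceRow n B b d = begin
    ∑[ k < N ] (sgn R (toℕ k) * (B zero k * ∑[ i < n ] (b (suc i) * D k i)))
      ≈⟨ sum-cong-≋ pull ⟩
    ∑[ k < N ] ∑[ i < n ] (b (suc i) * (sgn R (toℕ k) * (B zero k * D k i)))
      ≈⟨ ∑-comm (λ k i → b (suc i) * (sgn R (toℕ k) * (B zero k * D k i))) ⟩
    ∑[ i < n ] ∑[ k < N ] (b (suc i) * (sgn R (toℕ k) * (B zero k * D k i)))
      ≈⟨ sum-cong-≋ (λ i → sym (*-distribˡ-sum (b (suc i)) (λ k → sgn R (toℕ k) * (B zero k * D k i)))) ⟩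
    ∑[ i < n ] (b (suc i) * ∑[ k < N ] (sgn R (toℕ k) * (B zero k * D k i)))
      ≈⟨ sum-cong-≋ (λ i → *-congˡ {b (suc i)} (sym (expand i))) ⟩
    ∑[ i < n ] (b (suc i) * det R N (replaceRow B (suc i) d)) ∎
    where
    N : ℕ
    N = suc n
    D : Fin N → Fin n → Carrier
    D k i = det R n (replaceRow (minor k B) i (d ∘ punchIn k))
    expand : ∀ i → det R N (replaceRow B (suc i) d) ≈ ∑[ k < N ] (sgn R (toℕ k) * (B zero k * D k i))
    expand i = trans (det-suc n (replaceRow B (suc i) d)) (sum-cong-≋ (λ k →
      *-congˡ {sgn R (toℕ k)} (*-congˡ {B zero k} (det-cong n (λ r s → reflexive (minor-replaceRow k B i d r s))))))
    rearrange : ∀ s x y z → s * (x * (y * z)) ≈ y * (s * (x * z))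
    rearrange = solve 4 (λ s x y z → s :* (x :* (y :* z)) := y :* (s :* (x :* z))) refl
    pull : ∀ k → sgn R (toℕ k) * (B zero k * ∑[ i < n ] (b (suc i) * D k i))
                 ≈ ∑[ i < n ] (b (suc i) * (sgn R (toℕ k) * (B zero k * D k i)))
    pull k = begin
      sgn R (toℕ k) * (B zero k * ∑[ i < n ] (b (suc i) * D k i))
        ≈⟨ *-congˡ {sgn R (toℕ k)} (*-distribˡ-sum (B zero k) (λ i → b (suc i) * D k i)) ⟩
      sgn R (toℕ k) * ∑[ i < n ] (B zero k * (b (suc i) * D k i))
        ≈⟨ *-distribˡ-sum (sgn R (toℕ k)) (λ i → B zero k * (b (suc i) * D k i)) ⟩
      ∑[ i < n ] (sgn R (toℕ k) * (B zero k * (b (suc i) * D k i)))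
        ≈⟨ sum-cong-≋ (λ i → rearrange (sgn R (toℕ k)) (B zero k) (b (suc i)) (D k i)) ⟩
      ∑[ i < n ] (b (suc i) * (sgn R (toℕ k) * (B zero k * D k i))) ∎

  det-replaceRow-twice : ∀ n (B : Matrix (suc n)) d i → det R (suc n) (replaceRow (replaceRow B zero d) (suc i) d) ≈ 0#
  det-replaceRow-twice (suc n) B d i =
    det-equal-rows n (replaceRow (replaceRow B zero d) (suc i) d) i
      (λ s → reflexive (≡.sym (≡.cong-app (Vector.updateAt-updates i {const d} (λ r → B (suc r))) s)))

  -- The matrix determinant lemma, in a form that needs no inverse of B.
  det-rank-one-update : ∀ n (B : Matrix n) (b d : Fin n → Carrier) →
    det R n (λ i j → B i j - b i * d j) ≈ det R n B - ∑[ i < n ] (b i * det R n (replaceRow B i d))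
  det-rank-one-update zero    B b d = sym (trans (+-congˡ -0#≈0#) (+-identityʳ 1#))
  det-rank-one-update (suc n) B b d = begin
    det R N (λ i j → B i j - b i * d j)
      ≈⟨ det-suc n (λ i j → B i j - b i * d j) ⟩
    ∑[ k < N ] (sgn R (toℕ k) * ((B zero k - b zero * d k) * det R n (λ r s → minor k B r s - b (suc r) * d (punchIn k s))))
      ≈⟨ sum-cong-≋ (λ k → trans (*-congˡ {sgn R (toℕ k)} (*-congˡ {B zero k - b zero * d k}
           (det-rank-one-update n (minor k B) (b ∘ suc) (d ∘ punchIn k)))) (expand _ _ _ _ _ _)) ⟩
    ∑[ k < N ] ((laplaceTerm n B k - b zero * laplaceTerm n B₀ k) - (correction (B zero) k - b zero * correction d k))
      ≈⟨ sum-distrib-- (λ k → laplaceTerm n B k - b zero * laplaceTerm n B₀ k) (λ k → correction (B zero) k - b zero * correction d k) ⟩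
    ∑[ k < N ] (laplaceTerm n B k - b zero * laplaceTerm n B₀ k) - ∑[ k < N ] (correction (B zero) k - b zero * correction d k)
      ≈⟨ +-cong (sum-distrib-- (laplaceTerm n B) (λ k → b zero * laplaceTerm n B₀ k))
                (-‿cong (sum-distrib-- (correction (B zero)) (λ k → b zero * correction d k))) ⟩
    (sum (laplaceTerm n B) - ∑[ k < N ] (b zero * laplaceTerm n B₀ k)) - (sum (correction (B zero)) - ∑[ k < N ] (b zero * correction d k))
      ≈⟨ +-cong (+-cong (sym (det-suc n B)) (-‿cong (trans (sym (*-distribˡ-sum (b zero) (laplaceTerm n B₀))) (*-congˡ (sym (det-suc n B₀))))))
                (-‿cong (+-cong (sum-laplace-replaceRow n B b d)
                                (-‿cong (trans (sym (*-distribˡ-sum (b zero) (correction d))) (*-congˡ correction-vanishes))))) ⟩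
    (det R N B - b zero * det R N B₀) - (∑[ i < n ] (b (suc i) * det R N (replaceRow B (suc i) d)) - b zero * 0#)
      ≈⟨ collect _ _ _ _ ⟩
    det R N B - (b zero * det R N B₀ + ∑[ i < n ] (b (suc i) * det R N (replaceRow B (suc i) d))) ∎
    where
    N : ℕ
    N = suc n
    B₀ : Matrix N
    B₀ = replaceRow B zero d
    correction : (Fin N → Carrier) → Fin N → Carrier
    correction y k = sgn R (toℕ k) * (y k * ∑[ i < n ] (b (suc i) * det R n (replaceRow (minor k B) i (d ∘ punchIn k))))
    correction-vanishes : sum (correction d) ≈ 0#
    correction-vanishes = trans (sum-laplace-replaceRow n B₀ b d)
      (sum-zero _ (λ i → trans (*-congˡ (det-replaceRow-twice n B d i)) (zeroʳ _)))
    expand : ∀ s B₀ₖ b₀ dₖ m e → s * ((B₀ₖ - b₀ * dₖ) * (m - e)) ≈ (s * (B₀ₖ * m) - b₀ * (s * (dₖ * m))) - (s * (B₀ₖ * e) - b₀ * (s * (dₖ * e)))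
    expand = solve 6 (λ s B₀ₖ b₀ dₖ m e → s :* ((B₀ₖ :- b₀ :* dₖ) :* (m :- e))
                                        := (s :* (B₀ₖ :* m) :- b₀ :* (s :* (dₖ :* m))) :- (s :* (B₀ₖ :* e) :- b₀ :* (s :* (dₖ :* e)))) refl
    collect : ∀ a x y z → (a - x) - (y - z * 0#) ≈ a - (x + y)
    collect = solve 4 (λ a x y z → (a :- x) :- (y :- z :* con (+ 0)) := a :- (x :+ y)) refl

  updateAt-cong-≈ : ∀ {n m} {M N : Fin n → Fin m → Carrier} → (∀ r s → M r s ≈ N r s) →
                    ∀ i y r s → updateAt M i (const y) r s ≈ updateAt N i (const y) r s
  updateAt-cong-≈ M≈N zero    y zero    s = refl
  updateAt-cong-≈ M≈N zero    y (suc r) s = M≈N (suc r) s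
  updateAt-cong-≈ M≈N (suc i) y zero    s = M≈N zero s
  updateAt-cong-≈ M≈N (suc i) y (suc r) s = updateAt-cong-≈ (λ r → M≈N (suc r)) i y r s

  scalar : ∀ {n} → Carrier → Matrix n
  scalar x r s = x * δ R r s

  scalar-offDiagonal : ∀ {n} x (r s : Fin n) → r ≢ s → scalar x r s ≈ 0#
  scalar-offDiagonal x zero    zero    r≢s = ⊥-elim (r≢s ≡.refl)
  scalar-offDiagonal x zero    (suc s) r≢s = zeroʳ x
  scalar-offDiagonal x (suc r) zero    r≢s = zeroʳ x
  scalar-offDiagonal x (suc r) (suc s) r≢s = scalar-offDiagonal x r s (r≢s ∘ ≡.cong suc)

  det-scalar-row₀ : ∀ n x (M : Matrix (suc n)) → (∀ s → M zero s ≈ scalar x zero s) → det R (suc n) M ≈ x * det R n (minor zero M)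
  det-scalar-row₀ n x M row₀ = begin
    det R (suc n) M                         ≈⟨ det-single-entry-row₀ n M zero (λ s s≢0 → trans (row₀ s) (scalar-offDiagonal x zero s (s≢0 ∘ ≡.sym))) ⟩
    1# * (M zero zero * det R n (minor zero M)) ≈⟨ *-identityˡ _ ⟩
    M zero zero * det R n (minor zero M)    ≈⟨ *-congʳ (trans (row₀ zero) (*-identityʳ x)) ⟩
    x * det R n (minor zero M)              ∎

  det-scalar : ∀ n x → det R n (scalar x) ≈ pow R x n
  det-scalar zero    x = refl
  det-scalar (suc n) x = trans (det-scalar-row₀ n x (scalar x) (λ s → refl)) (*-congˡ (det-scalar n x))

  det-scalar-replaceRow : ∀ n x i (y : Fin (suc n) → Carrier) → det R (suc n) (replaceRow (scalar x) i y) ≈ y i * pow R x n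
  det-scalar-replaceRow n x zero y = begin
    det R (suc n) M                          ≈⟨ det-single-term n M zero (λ k k≢0 → laplaceTerm-zero n M k (minor-vanishes k k≢0)) ⟩
    laplaceTerm n M zero                     ≈⟨ *-identityˡ _ ⟩
    y zero * det R n (scalar x)              ≈⟨ *-congˡ (det-scalar n x) ⟩
    y zero * pow R x n                       ∎
    where
    M : Matrix (suc n)
    M = replaceRow (scalar x) zero y
    minor-vanishes : ∀ k → k ≢ zero → M zero k * det R n (minor k M) ≈ 0#
    minor-vanishes zero    k≢0 = ⊥-elim (k≢0 ≡.refl)
    minor-vanishes (suc k) _   = trans (*-congˡ (det-zero-row n (minor (suc k) M) k
      (λ s → scalar-offDiagonal x (suc k) (punchIn (suc k) s) (Fin.punchInᵢ≢i (suc k) s ∘ ≡.sym)))) (zeroʳ _)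
  det-scalar-replaceRow (suc n) x (suc i) y = begin
    det R (suc (suc n)) (replaceRow (scalar x) (suc i) y)
      ≈⟨ det-scalar-row₀ (suc n) x (replaceRow (scalar x) (suc i) y) (λ s → refl) ⟩
    x * det R (suc n) (minor zero (replaceRow (scalar x) (suc i) y))
      ≈⟨ *-congˡ (det-cong (suc n) (λ r s → reflexive (minor-replaceRow zero (scalar x) i y r s))) ⟩
    x * det R (suc n) (replaceRow (scalar x) i (y ∘ suc))
      ≈⟨ *-congˡ (det-scalar-replaceRow n x i (y ∘ suc)) ⟩
    x * (y (suc i) * pow R x n)
      ≈⟨ x∙yz≈y∙xz x _ _ ⟩
    y (suc i) * pow R x (suc n) ∎
    where open import Algebra.Properties.CommutativeSemigroup *-commutativeSemigroup using (x∙yz≈y∙xz)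

  sgn-squared : ∀ k → sgn R k * sgn R k ≈ 1#
  sgn-squared zero    = *-identityˡ 1#
  sgn-squared (suc k) = trans (solve 1 (λ s → (:- s) :* (:- s) := s :* s) refl (sgn R k)) (sgn-squared k)

  det-minor-scalar-replaceRow : ∀ n x k (z : Fin (suc (suc n)) → Carrier) →
    det R (suc n) (minor (suc k) (replaceRow (scalar x) (suc k) z)) ≈ sgn R (toℕ k) * (z zero * pow R x n)
  det-minor-scalar-replaceRow n x zero z = begin
    det R (suc n) (minor (suc zero) (replaceRow (scalar x) (suc zero) z))
      ≈⟨ det-cong (suc n) entries ⟩
    det R (suc n) (replaceRow (scalar x) zero (z ∘ punchIn (suc zero)))
      ≈⟨ det-scalar-replaceRow n x zero (z ∘ punchIn (suc zero)) ⟩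
    z zero * pow R x n
      ≈⟨ *-identityˡ _ ⟨
    1# * (z zero * pow R x n) ∎
    where
    entries : ∀ r s → minor (suc zero) (replaceRow (scalar x) (suc zero) z) r s ≈ replaceRow (scalar x) zero (z ∘ punchIn (suc zero)) r s
    entries zero    s       = refl
    entries (suc r) zero    = refl
    entries (suc r) (suc s) = refl
  det-minor-scalar-replaceRow (suc n) x (suc k) z = begin
    det R (suc (suc n)) S
      ≈⟨ det-single-entry-row₀ (suc n) S (suc zero) row₀ ⟩
    - 1# * ((x * 1#) * det R (suc n) (minor (suc zero) S))
      ≈⟨ *-congˡ (*-congˡ (det-cong (suc n) entries)) ⟩
    - 1# * ((x * 1#) * det R (suc n) (minor (suc k) (replaceRow (scalar x) (suc k) (z ∘ punchIn (suc zero)))))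
      ≈⟨ *-congˡ (*-congˡ (det-minor-scalar-replaceRow n x k (z ∘ punchIn (suc zero)))) ⟩
    - 1# * ((x * 1#) * (sgn R (toℕ k) * (z zero * pow R x n)))
      ≈⟨ solve 4 (λ x s z₀ p → (:- con (+ 1)) :* ((x :* con (+ 1)) :* (s :* (z₀ :* p))) := (:- s) :* (z₀ :* (x :* p))) refl x _ _ _ ⟩
    (- sgn R (toℕ k)) * (z zero * (x * pow R x n)) ∎
    where
    S : Matrix (suc (suc n))
    S = minor (suc (suc k)) (replaceRow (scalar x) (suc (suc k)) z)
    row₀ : ∀ s → s ≢ suc zero → S zero s ≈ 0#
    row₀ zero          _   = zeroʳ x
    row₀ (suc zero)    s≢1 = ⊥-elim (s≢1 ≡.refl)
    row₀ (suc (suc s)) _   = zeroʳ x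
    punchIn-comm : ∀ s → punchIn (suc (suc k)) (punchIn (suc zero) s) ≡ punchIn (suc zero) (punchIn (suc k) s)
    punchIn-comm zero    = ≡.refl
    punchIn-comm (suc s) = ≡.refl
    shift : ∀ r t → scalar x (suc (suc r)) (punchIn (suc zero) t) ≈ scalar x (suc r) t
    shift r zero    = refl
    shift r (suc t) = refl
    entries : ∀ r s → minor (suc zero) S r s ≈ minor (suc k) (replaceRow (scalar x) (suc k) (z ∘ punchIn (suc zero))) r s
    entries r s = begin
      updateAt (λ r → scalar x (suc (suc r))) k (const z) r (punchIn (suc (suc k)) (punchIn (suc zero) s))
        ≡⟨ ≡.cong (updateAt (λ r → scalar x (suc (suc r))) k (const z) r) (punchIn-comm s) ⟩
      updateAt (λ r → scalar x (suc (suc r))) k (const z) r (punchIn (suc zero) (punchIn (suc k) s))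
        ≡⟨ ≡.cong-app (Vector.map-updateAt {f = _∘ punchIn (suc zero)} {g = const z} (λ _ → ≡.refl) (λ r → scalar x (suc (suc r))) k r) (punchIn (suc k) s) ⟩
      updateAt (λ r → scalar x (suc (suc r)) ∘ punchIn (suc zero)) k (const (z ∘ punchIn (suc zero))) r (punchIn (suc k) s)
        ≈⟨ updateAt-cong-≈ shift k (z ∘ punchIn (suc zero)) r (punchIn (suc k) s) ⟩
      updateAt (λ r → scalar x (suc r)) k (const (z ∘ punchIn (suc zero))) r (punchIn (suc k) s) ∎

  det-scalar-replaceRows₀ : ∀ n x k (y z : Fin (suc (suc n)) → Carrier) →
    det R (suc (suc n)) (replaceRow (replaceRow (scalar x) zero y) (suc k) z) ≈ pow R x n * (y zero * z (suc k) - y (suc k) * z zero)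
  det-scalar-replaceRows₀ n x k y z = begin
    det R (suc (suc n)) M
      ≈⟨ det-suc (suc n) M ⟩
    laplaceTerm (suc n) M zero + ∑[ j < suc n ] laplaceTerm (suc n) M (suc j)
      ≈⟨ +-cong (*-identityˡ _) (sum-single (laplaceTerm (suc n) M ∘ suc) k others) ⟩
    y zero * det R (suc n) (minor zero M) + (- sgn R (toℕ k)) * (y (suc k) * det R (suc n) (minor (suc k) M))
      ≈⟨ +-cong (*-congˡ (trans (det-cong (suc n) (λ r t → reflexive (minor-replaceRow zero (replaceRow (scalar x) zero y) k z r t))) (det-scalar-replaceRow n x k (z ∘ suc)))) (*-congˡ { - sgn R (toℕ k)} (*-congˡ (det-minor-scalar-replaceRow n x k z))) ⟩
    y zero * (z (suc k) * p) + (- s) * (y (suc k) * (s * (z zero * p)))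
      ≈⟨ +-congˡ (solve 4 (λ s y z p → (:- s) :* (y :* (s :* (z :* p))) := :- ((s :* s) :* (y :* z :* p))) refl s _ _ _) ⟩
    y zero * (z (suc k) * p) - (s * s) * (y (suc k) * z zero * p)
      ≈⟨ +-congˡ (-‿cong (*-congʳ (sgn-squared (toℕ k)))) ⟩
    y zero * (z (suc k) * p) - 1# * (y (suc k) * z zero * p)
      ≈⟨ solve 5 (λ y₀ zₖ yₖ z₀ p → y₀ :* (zₖ :* p) :- con (+ 1) :* (yₖ :* z₀ :* p) := p :* (y₀ :* zₖ :- yₖ :* z₀)) refl _ _ _ _ p ⟩
    p * (y zero * z (suc k) - y (suc k) * z zero) ∎
    where
    M : Matrix (suc (suc n))
    M = replaceRow (replaceRow (scalar x) zero y) (suc k) z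
    p : Carrier
    p = pow R x n
    s : Carrier
    s = sgn R (toℕ k)
    others : ∀ m → m ≢ k → laplaceTerm (suc n) M (suc m) ≈ 0#
    others m m≢k = laplaceTerm-zero (suc n) M (suc m) (trans (*-congˡ (det-zero-row (suc n) (minor (suc m) M) m (λ t →
      trans (reflexive (≡.cong-app (Vector.updateAt-minimal m k (λ r → scalar x (suc r)) m≢k) (punchIn (suc m) t)))
            (scalar-offDiagonal x (suc m) (punchIn (suc m) t) (Fin.punchInᵢ≢i (suc m) t ∘ ≡.sym))))) (zeroʳ _))

  det-scalar-replaceRows : ∀ n x i k → i ≢ k → ∀ (y z : Fin (suc (suc n)) → Carrier) →
    det R (suc (suc n)) (replaceRow (replaceRow (scalar x) i y) k z) ≈ pow R x n * (y i * z k - y k * z i)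
  det-scalar-replaceRows n x zero zero i≢k y z = ⊥-elim (i≢k ≡.refl)
  det-scalar-replaceRows n x zero (suc k) i≢k y z = det-scalar-replaceRows₀ n x k y z
  det-scalar-replaceRows n x (suc i) zero i≢k y z = begin
    det R (suc (suc n)) (replaceRow (replaceRow (scalar x) (suc i) y) zero z)
      ≈⟨ det-cong (suc (suc n)) (λ r s → reflexive (≡.cong-app (Vector.updateAt-commutes zero (suc i) {const z} {const y} (λ ()) (scalar x) r) s)) ⟩
    det R (suc (suc n)) (replaceRow (replaceRow (scalar x) zero z) (suc i) y)
      ≈⟨ det-scalar-replaceRows₀ n x i z y ⟩
    pow R x n * (z zero * y (suc i) - z (suc i) * y zero)
      ≈⟨ *-congˡ (solve 4 (λ a b c d → a :* b :- c :* d := b :* a :- d :* c) refl _ _ _ _) ⟩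
    pow R x n * (y (suc i) * z zero - y zero * z (suc i)) ∎
  det-scalar-replaceRows zero    x (suc zero) (suc zero) i≢k y z = ⊥-elim (i≢k ≡.refl)
  det-scalar-replaceRows (suc n) x (suc i) (suc k) i≢k y z = begin
    det R (suc (suc (suc n))) M
      ≈⟨ det-scalar-row₀ (suc (suc n)) x M (λ s → refl) ⟩
    x * det R (suc (suc n)) (minor zero M)
      ≈⟨ *-congˡ (det-cong (suc (suc n)) entries) ⟩
    x * det R (suc (suc n)) (replaceRow (replaceRow (scalar x) i (y ∘ suc)) k (z ∘ suc))
      ≈⟨ *-congˡ (det-scalar-replaceRows n x i k (i≢k ∘ ≡.cong suc) (y ∘ suc) (z ∘ suc)) ⟩
    x * (pow R x n * (y (suc i) * z (suc k) - y (suc k) * z (suc i)))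
      ≈⟨ *-assoc _ _ _ ⟨
    pow R x (suc n) * (y (suc i) * z (suc k) - y (suc k) * z (suc i)) ∎
    where
    M : Matrix (suc (suc (suc n)))
    M = replaceRow (replaceRow (scalar x) (suc i) y) (suc k) z
    entries : ∀ r s → minor zero M r s ≈ replaceRow (replaceRow (scalar x) i (y ∘ suc)) k (z ∘ suc) r s
    entries r s = trans (reflexive (minor-replaceRow zero (replaceRow (scalar x) (suc i) y) k z r s))
                        (updateAt-cong-≈ (λ r s → reflexive (minor-replaceRow zero (scalar x) i y r s)) k (z ∘ suc) r s)

  det-scalar-minus-rank-one : ∀ n x (a c : Fin (suc n) → Carrier) →
    det R (suc n) (λ i j → scalar x i j - a i * c j) ≈ pow R x (suc n) - a · c * pow R x n
  det-scalar-minus-rank-one n x a c = begin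
    det R (suc n) (λ i j → scalar x i j - a i * c j)
      ≈⟨ det-rank-one-update (suc n) (scalar x) a c ⟩
    det R (suc n) (scalar x) - ∑[ k < suc n ] (a k * det R (suc n) (replaceRow (scalar x) k c))
      ≈⟨ +-cong (det-scalar (suc n) x) (-‿cong (sum-cong-≋ (λ k → trans (*-congˡ {a k} (det-scalar-replaceRow n x k c)) (sym (*-assoc (a k) (c k) (pow R x n)))))) ⟩
    pow R x (suc n) - ∑[ k < suc n ] (a k * c k * pow R x n)
      ≈⟨ +-congˡ (-‿cong (*-distribʳ-sum (pow R x n) (λ k → a k * c k))) ⟨
    pow R x (suc n) - a · c * pow R x n ∎

  det-replaceRow-scalar-minus-rank-one : ∀ m x (a c d : Fin (suc (suc m)) → Carrier) i →
    det R (suc (suc m)) (replaceRow (λ i j → scalar x i j - a i * c j) i d)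
      ≈ d i * pow R x (suc m) - ((pow R x m * d i) * a · c + (- (pow R x m * c i)) * a · d)
  det-replaceRow-scalar-minus-rank-one m x a c d i = begin
    det R N (replaceRow (λ i j → scalar x i j - a i * c j) i d)
      ≈⟨ det-cong N (replaceRow-minus-rank-one (scalar x) a c d i) ⟩
    det R N (λ r s → replaceRow (scalar x) i d r s - a′ r * c s)
      ≈⟨ det-rank-one-update N (replaceRow (scalar x) i d) a′ c ⟩
    det R N (replaceRow (scalar x) i d) - ∑[ k < N ] (a′ k * det R N (replaceRow (replaceRow (scalar x) i d) k c))
      ≈⟨ +-cong (det-scalar-replaceRow (suc m) x i d) (-‿cong (sum-cong-≋ term)) ⟩
    d i * pow R x (suc m) - ∑[ k < N ] ((pow R x m * d i) * (a k * c k) + (- (pow R x m * c i)) * (a k * d k))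
      ≈⟨ +-congˡ (-‿cong (sum-linear (pow R x m * d i) (- (pow R x m * c i)) (λ k → a k * c k) (λ k → a k * d k))) ⟩
    d i * pow R x (suc m) - ((pow R x m * d i) * a · c + (- (pow R x m * c i)) * a · d) ∎
    where
    N : ℕ
    N = suc (suc m)
    a′ : Fin N → Carrier
    a′ = updateAt a i (const 0#)
    replaceRow-minus-rank-one : ∀ {n} (S : Fin n → Fin N → Carrier) (a : Fin n → Carrier) (c d : Fin N → Carrier) i r s →
      updateAt (λ r s → S r s - a r * c s) i (const d) r s ≈ updateAt S i (const d) r s - updateAt a i (const 0#) r * c s
    replaceRow-minus-rank-one S a c d zero    zero    s = solve 2 (λ u v → u := u :- con (+ 0) :* v) refl (d s) (c s)
    replaceRow-minus-rank-one S a c d zero    (suc r) s = refl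
    replaceRow-minus-rank-one S a c d (suc i) zero    s = refl
    replaceRow-minus-rank-one S a c d (suc i) (suc r) s = replaceRow-minus-rank-one (S ∘ suc) (a ∘ suc) c d i r s
    expand : ∀ aₖ p dᵢ cₖ dₖ cᵢ → aₖ * (p * (dᵢ * cₖ - dₖ * cᵢ)) ≈ (p * dᵢ) * (aₖ * cₖ) + (- (p * cᵢ)) * (aₖ * dₖ)
    expand = solve 6 (λ aₖ p dᵢ cₖ dₖ cᵢ → aₖ :* (p :* (dᵢ :* cₖ :- dₖ :* cᵢ)) := (p :* dᵢ) :* (aₖ :* cₖ) :+ (:- (p :* cᵢ)) :* (aₖ :* dₖ)) refl
    term : ∀ k → a′ k * det R N (replaceRow (replaceRow (scalar x) i d) k c)
                 ≈ (pow R x m * d i) * (a k * c k) + (- (pow R x m * c i)) * (a k * d k)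
    term k with k Fin.≟ i
    ... | yes ≡.refl = trans (*-congʳ (reflexive (Vector.updateAt-updates k a))) (trans (zeroˡ _)
                         (solve 4 (λ aₖ p dₖ cₖ → con (+ 0) := (p :* dₖ) :* (aₖ :* cₖ) :+ (:- (p :* cₖ)) :* (aₖ :* dₖ)) refl (a k) (pow R x m) (d k) (c k)))
    ... | no k≢i = trans (*-cong (reflexive (Vector.updateAt-minimal k i a k≢i)) (det-scalar-replaceRows m x i k (k≢i ∘ ≡.sym) d c))
                         (expand (a k) (pow R x m) (d i) (c k) (d k) (c i))

  det-scalar-minus-rank-two : ∀ m x (a b c d : Fin (suc (suc m)) → Carrier) →
    det R (suc (suc m)) (λ i j → scalar x i j - (a i * c j + b i * d j))
      ≈ (pow R x (suc (suc m)) - (a · c + b · d) * pow R x (suc m)) + (b · d * a · c - b · c * a · d) * pow R x m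
  det-scalar-minus-rank-two m x a b c d = begin
    det R N (λ i j → scalar x i j - (a i * c j + b i * d j))
      ≈⟨ det-cong N (λ i j → solve 3 (λ u v w → u :- (v :+ w) := (u :- v) :- w) refl (scalar x i j) (a i * c j) (b i * d j)) ⟩
    det R N (λ i j → (scalar x i j - a i * c j) - b i * d j)
      ≈⟨ det-rank-one-update N (λ i j → scalar x i j - a i * c j) b d ⟩
    det R N (λ i j → scalar x i j - a i * c j) - ∑[ i < N ] (b i * det R N (replaceRow (λ i j → scalar x i j - a i * c j) i d))
      ≈⟨ +-cong (det-scalar-minus-rank-one (suc m) x a c) (-‿cong (sum-cong-≋ (λ i →
           trans (*-congˡ (det-replaceRow-scalar-minus-rank-one m x a c d i)) (expand (b i) (d i) (c i) q p (a · c) (a · d))))) ⟩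
    (pow R x N - a · c * q) - ∑[ i < N ] ((q - p * a · c) * (b i * d i) + (p * a · d) * (b i * c i))
      ≈⟨ +-congˡ (-‿cong (sum-linear (q - p * a · c) (p * a · d) (λ i → b i * d i) (λ i → b i * c i))) ⟩
    (pow R x N - a · c * q) - ((q - p * a · c) * b · d + (p * a · d) * b · c)
      ≈⟨ solve 7 (λ xᴺ q p ac bd ad bc → (xᴺ :- ac :* q) :- ((q :- p :* ac) :* bd :+ (p :* ad) :* bc)
                                        := (xᴺ :- (ac :+ bd) :* q) :+ (bd :* ac :- bc :* ad) :* p) refl _ q p (a · c) (b · d) (a · d) (b · c) ⟩
    (pow R x N - (a · c + b · d) * q) + (b · d * a · c - b · c * a · d) * p ∎
    where
    N : ℕ
    N = suc (suc m)
    q : Carrier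
    q = pow R x (suc m)
    p : Carrier
    p = pow R x m
    expand : ∀ bᵢ dᵢ cᵢ q p ac ad → bᵢ * (dᵢ * q - ((p * dᵢ) * ac + (- (p * cᵢ)) * ad)) ≈ (q - p * ac) * (bᵢ * dᵢ) + (p * ad) * (bᵢ * cᵢ)
    expand = solve 7 (λ bᵢ dᵢ cᵢ q p ac ad → bᵢ :* (dᵢ :* q :- ((p :* dᵢ) :* ac :+ (:- (p :* cᵢ)) :* ad))
                                            := (q :- p :* ac) :* (bᵢ :* dᵢ) :+ (p :* ad) :* (bᵢ :* cᵢ)) refl

module LucasSequences {ℓ₁ ℓ₂ : Level} (R : CommutativeRing ℓ₁ ℓ₂) (A : CommutativeRing.Carrier R) where
  open import Data.Integer using (+_)
  open CommutativeRing R hiding (zero)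
  open import Relation.Binary.Reasoning.Setoid setoid
  open IntegerSolver R using (solve; _:=_; _:+_; _:*_; _:-_; :-_; con)
  open FiniteSums R

  u v : ℕ → Carrier
  u = lucasU R A (- 1#)
  v = lucasV R A (- 1#)

  -- u₋ k = u (k - 1); running the recurrence backwards gives u₋ 0 = u (-1) = 1.
  u₋ : ℕ → Carrier
  u₋ zero    = 1#
  u₋ (suc k) = u k

  minus-neg : ∀ x y z → x * y - (- 1#) * z ≈ x * y + z
  minus-neg = solve 3 (λ x y z → x :* y :- (:- con (+ 1)) :* z := x :* y :+ z) refl

  u-rec : ∀ k → u (suc (suc k)) ≈ A * u (suc k) + u k
  u-rec k = minus-neg A (u (suc k)) (u k)

  u-suc : ∀ k → u (suc k) ≈ A * u k + u₋ k
  u-suc zero    = solve 1 (λ a → con (+ 1) := a :* con (+ 0) :+ con (+ 1)) refl A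
  u-suc (suc k) = u-rec k

  u₋≈u-Au : ∀ k → u₋ k ≈ u (suc k) - A * u k
  u₋≈u-Au k = trans (solve 3 (λ a x y → y := (a :* x :+ y) :- a :* x) refl A (u k) (u₋ k)) (+-congʳ (sym (u-suc k)))

  v≈u+u₋ : ∀ k → v k ≈ u (suc k) + u₋ k
  v≈u+u₋ zero          = refl
  v≈u+u₋ (suc zero)    = solve 1 (λ a → a := (a :* con (+ 1) :- (:- con (+ 1)) :* con (+ 0)) :+ con (+ 0)) refl A
  v≈u+u₋ (suc (suc k)) = begin
    A * v (suc k) - (- 1#) * v k                          ≈⟨ minus-neg A (v (suc k)) (v k) ⟩
    A * v (suc k) + v k                                   ≈⟨ +-cong (*-congˡ (v≈u+u₋ (suc k))) (v≈u+u₋ k) ⟩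
    A * (u (suc (suc k)) + u k) + (u (suc k) + u₋ k)      ≈⟨ solve 5 (λ a u₂ u₀ u₁ u₋₁ → a :* (u₂ :+ u₀) :+ (u₁ :+ u₋₁) := (a :* u₂ :+ u₁) :+ (a :* u₀ :+ u₋₁)) refl A _ _ _ _ ⟩
    (A * u (suc (suc k)) + u (suc k)) + (A * u k + u₋ k)  ≈⟨ +-cong (u-rec (suc k)) (u-suc k) ⟨
    u (suc (suc (suc k))) + u (suc k)                     ∎

  cassini : ∀ n → u (suc n) * u₋ n - u n * u n ≈ sgn R n
  cassini zero    = solve 0 (con (+ 1) :* con (+ 1) :- con (+ 0) :* con (+ 0) := con (+ 1)) refl
  cassini (suc n) = begin
    u (suc (suc n)) * u n - u (suc n) * u (suc n)
      ≈⟨ +-cong (*-congʳ (u-rec n)) (-‿cong (*-cong (u-suc n) (u-suc n))) ⟩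
    (A * u (suc n) + u n) * u n - (A * u n + u₋ n) * (A * u n + u₋ n)
      ≈⟨ +-congʳ (*-congʳ (+-congʳ (*-congˡ (u-suc n)))) ⟩
    (A * (A * u n + u₋ n) + u n) * u n - (A * u n + u₋ n) * (A * u n + u₋ n)
      ≈⟨ solve 3 (λ a x y → (a :* (a :* x :+ y) :+ x) :* x :- (a :* x :+ y) :* (a :* x :+ y) := :- ((a :* x :+ y) :* y :- x :* x)) refl A (u n) (u₋ n) ⟩
    - ((A * u n + u₋ n) * u₋ n - u n * u n)
      ≈⟨ -‿cong (+-congʳ (*-congʳ (u-suc n))) ⟨
    - (u (suc n) * u₋ n - u n * u n)
      ≈⟨ -‿cong (cassini n) ⟩
    - sgn R n ∎

  sgn-even : ∀ q → sgn R (q ℕ.* 2) ≈ 1#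
  sgn-even zero    = refl
  sgn-even (suc q) = trans (solve 1 (λ s → :- (:- s) := s) refl _) (sgn-even q)

  X Y Z : ℕ → Carrier
  X n = ∑[ i < n ] (u (toℕ i) * u (toℕ i))
  Y n = ∑[ i < n ] (u (toℕ i) * u (suc (toℕ i)))
  Z n = ∑[ i < n ] (u (suc (toℕ i)) * u (suc (toℕ i)))

  A*X : ∀ n → A * X n ≈ u n * u₋ n
  A*X zero    = trans (zeroʳ A) (sym (zeroˡ 1#))
  A*X (suc n) = begin
    A * X (suc n)                     ≈⟨ *-congˡ (sum-snoc n (λ k → u k * u k)) ⟩
    A * (X n + u n * u n)             ≈⟨ distribˡ A _ _ ⟩
    A * X n + A * (u n * u n)         ≈⟨ +-congʳ (A*X n) ⟩
    u n * u₋ n + A * (u n * u n)      ≈⟨ solve 3 (λ a x y → x :* y :+ a :* (x :* x) := (a :* x :+ y) :* x) refl A (u n) (u₋ n) ⟩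
    (A * u n + u₋ n) * u n            ≈⟨ *-congʳ (u-suc n) ⟨
    u (suc n) * u n                   ∎

  A*Z : ∀ n → A * Z n ≈ u n * u (suc n)
  A*Z zero    = trans (zeroʳ A) (sym (zeroˡ _))
  A*Z (suc n) = begin
    A * Z (suc n)                                 ≈⟨ *-congˡ (sum-snoc n (λ k → u (suc k) * u (suc k))) ⟩
    A * (Z n + u (suc n) * u (suc n))             ≈⟨ distribˡ A _ _ ⟩
    A * Z n + A * (u (suc n) * u (suc n))         ≈⟨ +-congʳ (A*Z n) ⟩
    u n * u (suc n) + A * (u (suc n) * u (suc n)) ≈⟨ solve 3 (λ a x y → x :* y :+ a :* (y :* y) := y :* (a :* y :+ x)) refl A (u n) (u (suc n)) ⟩
    u (suc n) * (A * u (suc n) + u n)             ≈⟨ *-congˡ (u-rec n) ⟨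
    u (suc n) * u (suc (suc n))                   ∎

  -- The sums of u k u (k+1) telescope only over pairs of consecutive indices.
  A*Y-even : ∀ q → A * Y (q ℕ.* 2) ≈ u (q ℕ.* 2) * u (q ℕ.* 2)
  A*Y-even zero    = trans (zeroʳ A) (sym (zeroˡ _))
  A*Y-even (suc q) = begin
    A * Y (suc (suc n))
      ≈⟨ *-congˡ (trans (sum-snoc (suc n) f) (+-congʳ (sum-snoc n f))) ⟩
    A * ((Y n + u n * u (suc n)) + u (suc n) * u (suc (suc n)))
      ≈⟨ *-congˡ (+-congˡ (*-congˡ (u-rec n))) ⟩
    A * ((Y n + u n * u (suc n)) + u (suc n) * (A * u (suc n) + u n))
      ≈⟨ solve 4 (λ a y x₀ x₁ → a :* ((y :+ x₀ :* x₁) :+ x₁ :* (a :* x₁ :+ x₀)) := a :* y :+ (a :* x₁ :+ x₀) :* (a :* x₁ :+ x₀) :- x₀ :* x₀) refl A (Y n) (u n) (u (suc n)) ⟩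
    A * Y n + (A * u (suc n) + u n) * (A * u (suc n) + u n) - u n * u n
      ≈⟨ +-congʳ (+-congʳ (A*Y-even q)) ⟩
    u n * u n + (A * u (suc n) + u n) * (A * u (suc n) + u n) - u n * u n
      ≈⟨ solve 2 (λ s t → s :+ t :- s := t) refl (u n * u n) _ ⟩
    (A * u (suc n) + u n) * (A * u (suc n) + u n)
      ≈⟨ *-cong (u-rec n) (u-rec n) ⟨
    u (suc (suc n)) * u (suc (suc n)) ∎
    where
    n : ℕ
    n = q ℕ.* 2
    f : ℕ → Carrier
    f k = u k * u (suc k)

  module HankelMatrix (w : ℕ → Carrier) (w-rec : ∀ i → w (suc (suc i)) ≈ A * w (suc i) + w i) where
    w-decomposition : ∀ j k → w (j ℕ.+ k) ≈ u j * w (suc k) + u₋ j * w k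
    w-decomposition zero          k = solve 2 (λ x y → y := con (+ 0) :* x :+ con (+ 1) :* y) refl (w (suc k)) (w k)
    w-decomposition (suc zero)    k = solve 2 (λ x y → x := con (+ 1) :* x :+ con (+ 0) :* y) refl (w (suc k)) (w k)
    w-decomposition (suc (suc j)) k = begin
      w (suc (suc (j ℕ.+ k)))                               ≈⟨ w-rec (j ℕ.+ k) ⟩
      A * w (suc j ℕ.+ k) + w (j ℕ.+ k)                     ≈⟨ +-cong (*-congˡ (w-decomposition (suc j) k)) (w-decomposition j k) ⟩
      A * (u (suc j) * wₖ₊₁ + u j * wₖ) + (u j * wₖ₊₁ + u₋ j * wₖ)
        ≈⟨ solve 6 (λ a x₁ x₀ y x w → a :* (x₁ :* x :+ x₀ :* w) :+ (x₀ :* x :+ y :* w) := (a :* x₁ :+ x₀) :* x :+ (a :* x₀ :+ y) :* w) refl A (u (suc j)) (u j) (u₋ j) wₖ₊₁ wₖ ⟩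
      (A * u (suc j) + u j) * wₖ₊₁ + (A * u j + u₋ j) * wₖ    ≈⟨ +-cong (*-congʳ (u-rec j)) (*-congʳ (u-suc j)) ⟨
      u (suc (suc j)) * wₖ₊₁ + u (suc j) * wₖ                 ∎
      where
      wₖ₊₁ : Carrier
      wₖ₊₁ = w (suc k)
      wₖ : Carrier
      wₖ = w k

    w≈ : ∀ k → w k ≈ u k * w 1 + u₋ k * w 0
    w≈ k = trans (reflexive (≡.cong w (≡.sym (ℕ.+-identityʳ k)))) (w-decomposition k 0)

    sum-in-squares : ∀ n (f : ℕ → Carrier) α β γ →
      (∀ k → f k ≈ α * (u k * u k) + β * (u k * u (suc k)) + γ * (u (suc k) * u (suc k))) →
      ∑[ i < n ] f (toℕ i) ≈ α * X n + β * Y n + γ * Z n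
    sum-in-squares n f α β γ f≈ = begin
      ∑[ i < n ] f (toℕ i)
        ≈⟨ sum-cong-≋ {n} (λ i → f≈ (toℕ i)) ⟩
      ∑[ i < n ] ((α * (u (toℕ i) * u (toℕ i)) + β * (u (toℕ i) * u (suc (toℕ i)))) + γ * (u (suc (toℕ i)) * u (suc (toℕ i))))
        ≈⟨ ∑-distrib-+ {n} (λ i → α * (u (toℕ i) * u (toℕ i)) + β * (u (toℕ i) * u (suc (toℕ i)))) (λ i → γ * (u (suc (toℕ i)) * u (suc (toℕ i)))) ⟩
      ∑[ i < n ] (α * (u (toℕ i) * u (toℕ i)) + β * (u (toℕ i) * u (suc (toℕ i)))) + ∑[ i < n ] (γ * (u (suc (toℕ i)) * u (suc (toℕ i))))
        ≈⟨ +-cong (sum-linear {n} α β (λ i → u (toℕ i) * u (toℕ i)) (λ i → u (toℕ i) * u (suc (toℕ i))))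
                  (sym (*-distribˡ-sum {n} γ (λ i → u (suc (toℕ i)) * u (suc (toℕ i))))) ⟩
      α * X n + β * Y n + γ * Z n ∎

    w₀ w₁ : Carrier
    w₀ = w 0
    w₁ = w 1

    ac-in-squares : ∀ k → u k * w (suc k) ≈ w₀ * (u k * u k) + w₁ * (u k * u (suc k)) + 0# * (u (suc k) * u (suc k))
    ac-in-squares k = trans (*-congˡ (w≈ (suc k)))
      (solve 4 (λ x y p q → x :* (y :* q :+ x :* p) := p :* (x :* x) :+ q :* (x :* y) :+ con (+ 0) :* (y :* y)) refl (u k) (u (suc k)) w₀ w₁)

    bd-in-squares : ∀ k → u₋ k * w k ≈ (A * A * w₀ - A * w₁) * (u k * u k) + (w₁ - A * w₀ - A * w₀) * (u k * u (suc k)) + w₀ * (u (suc k) * u (suc k))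
    bd-in-squares k = trans (*-cong (u₋≈u-Au k) (trans (w≈ k) (+-congˡ (*-congʳ (u₋≈u-Au k)))))
      (solve 5 (λ a x y p q → (y :- a :* x) :* (x :* q :+ (y :- a :* x) :* p)
                             := (a :* a :* p :- a :* q) :* (x :* x) :+ (q :- a :* p :- a :* p) :* (x :* y) :+ p :* (y :* y)) refl A (u k) (u (suc k)) w₀ w₁)

    bc-in-squares : ∀ k → u₋ k * w (suc k) ≈ (- (A * w₀)) * (u k * u k) + (w₀ - A * w₁) * (u k * u (suc k)) + w₁ * (u (suc k) * u (suc k))
    bc-in-squares k = trans (*-cong (u₋≈u-Au k) (w≈ (suc k)))
      (solve 5 (λ a x y p q → (y :- a :* x) :* (y :* q :+ x :* p)
                             := (:- (a :* p)) :* (x :* x) :+ (p :- a :* q) :* (x :* y) :+ q :* (y :* y)) refl A (u k) (u (suc k)) w₀ w₁)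

    ad-in-squares : ∀ k → u k * w k ≈ (w₁ - A * w₀) * (u k * u k) + w₀ * (u k * u (suc k)) + 0# * (u (suc k) * u (suc k))
    ad-in-squares k = trans (*-congˡ (trans (w≈ k) (+-congˡ (*-congʳ (u₋≈u-Au k)))))
      (solve 5 (λ a x y p q → x :* (x :* q :+ (y :- a :* x) :* p)
                             := (q :- a :* p) :* (x :* x) :+ p :* (x :* y) :+ con (+ 0) :* (y :* y)) refl A (u k) (u (suc k)) w₀ w₁)

    module Vectors (n : ℕ) where
      a b c d : Fin n → Carrier
      a i = u (toℕ i)
      b i = u₋ (toℕ i)
      c i = w (suc (toℕ i))
      d i = w (toℕ i)

      hankel≈rank-two : ∀ j k → w (toℕ j ℕ.+ toℕ k) ≈ a j * c k + b j * d k
      hankel≈rank-two j k = w-decomposition (toℕ j) (toℕ k)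

    module EvenSize (q : ℕ) where
      m N : ℕ
      m = q ℕ.* 2
      N = suc (suc m)

      open Vectors N public

      U p : Carrier
      U = u N
      p = u (suc m)

      u-m : u m ≈ U - A * p
      u-m = trans (solve 3 (λ a x y → y := (a :* x :+ y) :- a :* x) refl A p (u m)) (+-congʳ (sym (u-rec m)))

      trace-identity : A * (a · c + b · d) ≈ (w₁ * v (suc m) + w₀ * v m) * U
      trace-identity = begin
        A * (a · c + b · d)
          ≈⟨ *-congˡ (+-cong (sum-in-squares N _ _ _ _ ac-in-squares) (sum-in-squares N _ _ _ _ bd-in-squares)) ⟩
        A * ((w₀ * X N + w₁ * Y N + 0# * Z N) + ((A * A * w₀ - A * w₁) * X N + (w₁ - A * w₀ - A * w₀) * Y N + w₀ * Z N))
          ≈⟨ solve 10 (λ a α₁ β₁ γ₁ α₂ β₂ γ₂ x y z → a :* ((α₁ :* x :+ β₁ :* y :+ γ₁ :* z) :+ (α₂ :* x :+ β₂ :* y :+ γ₂ :* z))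
                          := (α₁ :+ α₂) :* (a :* x) :+ (β₁ :+ β₂) :* (a :* y) :+ (γ₁ :+ γ₂) :* (a :* z))
                 refl A w₀ w₁ 0# (A * A * w₀ - A * w₁) (w₁ - A * w₀ - A * w₀) w₀ (X N) (Y N) (Z N) ⟩
        (w₀ + (A * A * w₀ - A * w₁)) * (A * X N) + (w₁ + (w₁ - A * w₀ - A * w₀)) * (A * Y N) + (0# + w₀) * (A * Z N)
          ≈⟨ +-cong (+-cong (*-congˡ (A*X N)) (*-congˡ (A*Y-even (suc q)))) (*-congˡ (trans (A*Z N) (*-congˡ (u-rec (suc m))))) ⟩
        (w₀ + (A * A * w₀ - A * w₁)) * (U * p) + (w₁ + (w₁ - A * w₀ - A * w₀)) * (U * U) + (0# + w₀) * (U * (A * U + p))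
          ≈⟨ solve 5 (λ a x₀ x₁ U p → (x₀ :+ (a :* a :* x₀ :- a :* x₁)) :* (U :* p) :+ (x₁ :+ (x₁ :- a :* x₀ :- a :* x₀)) :* (U :* U)
                                       :+ (con (+ 0) :+ x₀) :* (U :* (a :* U :+ p))
                                    := (x₁ :* (U :+ (U :- a :* p)) :+ x₀ :* (p :+ (p :- a :* (U :- a :* p)))) :* U) refl A w₀ w₁ U p ⟩
        (w₁ * (U + (U - A * p)) + w₀ * (p + (p - A * (U - A * p)))) * U
          ≈⟨ *-congʳ (+-cong (*-congˡ v-suc-m) (*-congˡ v-m)) ⟨
        (w₁ * v (suc m) + w₀ * v m) * U ∎
        where
        v-suc-m : v (suc m) ≈ U + (U - A * p)
        v-suc-m = trans (v≈u+u₋ (suc m)) (+-congˡ u-m)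
        v-m : v m ≈ p + (p - A * (U - A * p))
        v-m = trans (v≈u+u₋ m) (+-congˡ (trans (u₋≈u-Au m) (+-congˡ (-‿cong (*-congˡ u-m)))))

      second-coefficient-identity : A * A * (b · d * a · c - b · c * a · d) ≈ (w₀ * w₀ + A * w₀ * w₁ - w₁ * w₁) * (U * U)
      second-coefficient-identity = begin
        A * A * (b · d * a · c - b · c * a · d)
          ≈⟨ *-congˡ (+-cong (*-cong (sum-in-squares N _ _ _ _ bd-in-squares) (sum-in-squares N _ _ _ _ ac-in-squares))
                            (-‿cong (*-cong (sum-in-squares N _ _ _ _ bc-in-squares) (sum-in-squares N _ _ _ _ ad-in-squares)))) ⟩
        A * A * (((A * A * w₀ - A * w₁) * X N + (w₁ - A * w₀ - A * w₀) * Y N + w₀ * Z N) * (w₀ * X N + w₁ * Y N + 0# * Z N)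
                 - ((- (A * w₀)) * X N + (w₀ - A * w₁) * Y N + w₁ * Z N) * ((w₁ - A * w₀) * X N + w₀ * Y N + 0# * Z N))
          ≈⟨ solve 6 (λ a x₀ x₁ x y z → a :* a :* (((a :* a :* x₀ :- a :* x₁) :* x :+ (x₁ :- a :* x₀ :- a :* x₀) :* y :+ x₀ :* z) :* (x₀ :* x :+ x₁ :* y :+ con (+ 0) :* z)
                   :- ((:- (a :* x₀)) :* x :+ (x₀ :- a :* x₁) :* y :+ x₁ :* z) :* ((x₁ :- a :* x₀) :* x :+ x₀ :* y :+ con (+ 0) :* z))
                   := (x₀ :* x₀ :+ a :* x₀ :* x₁ :- x₁ :* x₁) :* ((a :* x) :* (a :* z) :- (a :* y) :* (a :* y))) refl A w₀ w₁ (X N) (Y N) (Z N) ⟩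
        κ * ((A * X N) * (A * Z N) - (A * Y N) * (A * Y N))
          ≈⟨ *-congˡ (+-cong (*-cong (A*X N) (A*Z N)) (-‿cong (*-cong (A*Y-even (suc q)) (A*Y-even (suc q))))) ⟩
        κ * ((U * p) * (U * u (suc N)) - (U * U) * (U * U))
          ≈⟨ solve 4 (λ κ U p U⁺ → κ :* ((U :* p) :* (U :* U⁺) :- (U :* U) :* (U :* U)) := κ :* (U :* U) :* (U⁺ :* p :- U :* U)) refl κ U p (u (suc N)) ⟩
        κ * (U * U) * (u (suc N) * p - U * U)
          ≈⟨ *-congˡ (trans (cassini N) (sgn-even (suc q))) ⟩
        κ * (U * U) * 1#
          ≈⟨ *-identityʳ _ ⟩
        κ * (U * U) ∎
        where
        κ : Carrier
        κ = w₀ * w₀ + A * w₀ * w₁ - w₁ * w₁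

module Units {ℓ₁ ℓ₂ : Level} (R : CommutativeRing ℓ₁ ℓ₂) where
  open CommutativeRing R
  open import Algebra.Properties.CommutativeSemigroup *-commutativeSemigroup using (interchange; x∙yz≈y∙xz)
  open import Relation.Binary.Reasoning.Setoid setoid

  *-cancel-unitˡ : ∀ {a a⁻¹ s t} → a * a⁻¹ ≈ 1# → a * s ≈ t → s ≈ t * a⁻¹
  *-cancel-unitˡ {a} {a⁻¹} {s} {t} a*a⁻¹≈1 a*s≈t = begin
    s                ≈⟨ *-identityʳ s ⟨
    s * 1#           ≈⟨ *-congˡ a*a⁻¹≈1 ⟨
    s * (a * a⁻¹)    ≈⟨ x∙yz≈y∙xz s a a⁻¹ ⟩
    a * (s * a⁻¹)    ≈⟨ *-assoc a s a⁻¹ ⟨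
    (a * s) * a⁻¹    ≈⟨ *-congʳ a*s≈t ⟩
    t * a⁻¹          ∎

  unit-* : ∀ {a a⁻¹ b b⁻¹} → a * a⁻¹ ≈ 1# → b * b⁻¹ ≈ 1# → (a * b) * (a⁻¹ * b⁻¹) ≈ 1#
  unit-* {a} {a⁻¹} {b} {b⁻¹} a*a⁻¹≈1 b*b⁻¹≈1 =
    trans (interchange a b a⁻¹ b⁻¹) (trans (*-cong a*a⁻¹≈1 b*b⁻¹≈1) (*-identityʳ 1#))

theorem1p4 : {c ℓ : Level} (R : CommutativeRing c ℓ) → IsFieldR R → CharZero R →
    let open CommutativeRing R hiding (zero)
        U = lucasU R
        V = lucasV R
    in (A : Carrier) → ¬ (A * (A * A + (1# + 1# + 1# + 1#)) ≈ 0#) →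
       (Ainv : Carrier) → A * Ainv ≈ 1# →
       (w : ℕ → Carrier) → ((i : ℕ) → w (suc (suc i)) ≈ A * w (suc i) + w i) →
       (n : ℕ) → 0 < n → 2 ∣ n → (x : Carrier) →
       det R n (λ j k → x * δ R j k - w (toℕ j +ℕ toℕ k))
         ≈ (pow R x n
            - ((w 1 * V A (- 1#) (n ∸ 1) + w 0 * V A (- 1#) (n ∸ 2)) * (U A (- 1#) n * Ainv))
              * pow R x (n ∸ 1))
           + ((w 0 * w 0 + A * w 0 * w 1 - w 1 * w 1) * pow R (U A (- 1#) n * Ainv) 2)
              * pow R x (n ∸ 2)
theorem1p4 R _ _ A _ Ainv A*Ainv≈1 w w-rec .(suc q ℕ.* 2) _ (divides (suc q) ≡.refl) x = begin
  det R N (λ j k → x * δ R j k - w (toℕ j +ℕ toℕ k))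
    ≈⟨ det-cong N (λ j k → +-congˡ {x * δ R j k} (-‿cong (hankel≈rank-two j k))) ⟩
  det R N (λ j k → scalar x j k - (a j * c k + b j * d k))
    ≈⟨ det-scalar-minus-rank-two m x a b c d ⟩
  (pow R x N - (a · c + b · d) * pow R x (suc m)) + (b · d * a · c - b · c * a · d) * pow R x m
    ≈⟨ +-cong (+-congˡ (-‿cong (*-congʳ trace))) (*-congʳ second-coefficient) ⟩
  (pow R x N - ((w 1 * v (suc m) + w 0 * v m) * (U * Ainv)) * pow R x (suc m)) + (κ * pow R (U * Ainv) 2) * pow R x m ∎
  where
  open CommutativeRing R hiding (zero)
  open import Relation.Binary.Reasoning.Setoid setoid
  open IntegerSolver R using (solve; _:=_; _:*_; con)
  open import Data.Integer using (+_)
  open FiniteSums R using (_·_)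
  open Determinants R using (det-cong; scalar; det-scalar-minus-rank-two)
  open LucasSequences R A using (u; v)
  open LucasSequences.HankelMatrix R A w w-rec
  open EvenSize q
  open Units R using (*-cancel-unitˡ; unit-*)
  κ : Carrier
  κ = w 0 * w 0 + A * w 0 * w 1 - w 1 * w 1
  trace : a · c + b · d ≈ (w 1 * v (suc m) + w 0 * v m) * (U * Ainv)
  trace = trans (*-cancel-unitˡ A*Ainv≈1 trace-identity) (*-assoc _ _ _)
  second-coefficient : b · d * a · c - b · c * a · d ≈ κ * pow R (U * Ainv) 2
  second-coefficient = trans (*-cancel-unitˡ (unit-* A*Ainv≈1 A*Ainv≈1) second-coefficient-identity)
    (solve 3 (λ κ U a⁻¹ → (κ :* (U :* U)) :* (a⁻¹ :* a⁻¹) := κ :* ((U :* a⁻¹) :* ((U :* a⁻¹) :* con (+ 1)))) refl κ U Ainv)
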